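{- Let $K$ be a quadratic field with ring of integers $\mathcal{O}_K$, and let $D$ be the unique square-free integer with $K=\mathbb{Q}(\sqrt{D})$. For $j\in\{1,2,3,4,6\}$ let $E_j=\{x\in\mathcal{O}_K: E(x)=j\}$, and let $i=\sqrt{ -1}$, $\omega=(-1+\sqrt{ -3})/2$, with $\overline{\omega}$ its complex conjugate. Then: 1) $E_1=\mathbb{Z}$; 2) $E_2=\{k\sqrt{D}: k\in\mathbb{Z},\ k\neq 0\}$; 3) $E_3\neq\emptyset$ if and only if $D=-3$, and $E_3=\{k\omega,\ k\overline{\omega}: k\in\mathbb{Z},\ k\neq 0\}$; 4) $E_4\neq\emptyset$ if and only if $D=-1$, and $E_4=\{k(1+i),\ k(1-i): k\in\mathbb{Z},\ k\neq 0\}$; 5) $E_6\neq\emptyset$ if and only if $D=-3$, and $E_6=\{k(1-\omega),\ k(1-\overline{\omega}): k\in\mathbb{Z},\ k\neq 0\}$.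
   Context: For $x\in\mathcal{O}_K$: if there is a positive integer $t$ with $x^t\in\mathbb{Z}$, the exponent $E(x)$ is the smallest such positive integer $t$; otherwise $E(x)=\infty$. -}

module Defs where

open import Data.Nat using (ℕ; zero; suc; _<_; _≤_)
import Data.Nat as ℕ
open import Data.Nat.Divisibility using (_∣_)
open import Data.Integer using (ℤ; +_; -_; _+_; _*_; _-_; ∣_∣)
open import Data.Integer.DivMod using (_%ℕ_; _/ℕ_)
open import Data.Product using (_×_; Σ; ∃; ∃-syntax; _,_)
open import Data.Sum using (_⊎_)
open import Relation.Binary.PropositionalEquality using (_≡_)
open import Relation.Nullary using (¬_)

-- D is square-free: the only natural n with n² ∣ |D| is n = 1 (this excludes D = 0).
SquareFree : ℤ → Set
SquareFree D = (n : ℕ) → (n ℕ.* n) ∣ ∣ D ∣ → n ≡ 1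

-- Ring of integers O_K of K = ℚ(√D), D square-free, D ≠ 1, in its standard
-- integral basis {1, θ}:  θ = √D if D ≢ 1 (mod 4),  θ = (1+√D)/2 if D ≡ 1 (mod 4).
-- ⟨ a , b ⟩ denotes a + bθ.
record 𝒪 (D : ℤ) : Set where
  constructor ⟨_,_⟩
  field
    fst snd : ℤ
open 𝒪 public

mulAux : ℕ → (D : ℤ) → 𝒪 D → 𝒪 D → 𝒪 D
-- D ≡ 1 (mod 4): θ² = θ + (D-1)/4
mulAux (suc zero) D ⟨ a , b ⟩ ⟨ c , d ⟩ =
  ⟨ a * c + b * d * ((D - + 1) /ℕ 4) , a * d + b * c + b * d ⟩
-- otherwise θ² = D
mulAux _ D ⟨ a , b ⟩ ⟨ c , d ⟩ = ⟨ a * c + b * d * D , a * d + b * c ⟩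

_·_ : {D : ℤ} → 𝒪 D → 𝒪 D → 𝒪 D
_·_ {D} x y = mulAux (D %ℕ 4) D x y

ι : {D : ℤ} → ℤ → 𝒪 D
ι k = ⟨ k , + 0 ⟩

_⊙_ : {D : ℤ} → ℤ → 𝒪 D → 𝒪 D
k ⊙ ⟨ a , b ⟩ = ⟨ k * a , k * b ⟩

IsInt : {D : ℤ} → 𝒪 D → Set
IsInt x = ∃[ k ] x ≡ ι k

_^_ : {D : ℤ} → 𝒪 D → ℕ → 𝒪 D
x ^ zero = ι (+ 1)
x ^ suc n = x · (x ^ n)

HasExponent : {D : ℤ} → 𝒪 D → ℕ → Set
HasExponent x j = 1 ≤ j × IsInt (x ^ j) × ((s : ℕ) → 1 ≤ s → s < j → ¬ IsInt (x ^ s))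

sqrtD : (D : ℤ) → 𝒪 D
sqrtD D with D %ℕ 4
... | suc zero = ⟨ - + 1 , + 2 ⟩   -- √D = 2θ - 1
... | _        = ⟨ + 0 , + 1 ⟩     -- √D = θ

conj : {D : ℤ} → 𝒪 D → 𝒪 D
conj {D} ⟨ a , b ⟩ with D %ℕ 4
... | suc zero = ⟨ a + b , - b ⟩   -- θ ↦ 1 - θ
... | _        = ⟨ a , - b ⟩       -- √D ↦ -√D

-- For D = -3 (θ = (1+√-3)/2):  ω = (-1+√-3)/2 = θ - 1
ω : 𝒪 (- + 3)
ω = ⟨ - + 1 , + 1 ⟩

-- For D = -1 (θ = √-1 = i):  1 + i
1+i : 𝒪 (- + 1)
1+i = ⟨ + 1 , + 1 ⟩

𝟙 : {D : ℤ} → 𝒪 D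
𝟙 = ι (+ 1)

_⊖_ : {D : ℤ} → 𝒪 D → 𝒪 D → 𝒪 D
⟨ a , b ⟩ ⊖ ⟨ c , d ⟩ = ⟨ a - c , b - d ⟩

{-# OPTIONS --safe #-}
module Submission where

-- Write x = a + bθ with trace t and norm N.  By Cayley–Hamilton x^(n+1) = U(n+1) x - N U(n),
-- where U is the Lucas sequence of (t, N); so b = 0 gives E(x) = 1, and for b ≠ 0 the exponent
-- E(x) is the least n ≥ 1 with U(n) = 0.  Since U(2) = t, U(3) = t² - N, U(4) = t (t² - 2N) and
-- U(6) = t (t² - N)(t² - 3N), E(x) = 2 exactly when t = 0, i.e. x ∈ ℤ√D, while E(x) = 3, 4, 6
-- force t² = N, 2N, 3N.  Substituting into t² - 4N = D w² with w ≠ 0 gives D w² = -3t²,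
-- D w² = -t² and D (3w)² = -3t², and a square-free D then equals -3, -1 and -3.  For these D
-- the relation t² = cN factors into two lines through the origin, spanned by the stated
-- generators; conversely the generators have the right exponent by computation, and E is
-- invariant under multiplication by nonzero integers.

open import Defs
open import Data.Integer using (ℤ; +_; -_; -[1+_]; 0ℤ; 1ℤ; _+_; _*_; _-_; ∣_∣)
import Data.Integer as ℤ
import Data.Integer.Properties as ℤ
open import Data.Integer.DivMod using (_%ℕ_; _/ℕ_; a≡a%ℕn+[a/ℕn]*n; n%ℕd<d)
open import Data.Integer.Solver using (module +-*-Solver)
open import Data.Integer.Tactic.RingSolver using (solve-∀)
import Data.Nat.Tactic.RingSolver as ℕ-Solver
open import Data.Nat using (ℕ; zero; suc; _≤_; _<_; _≤?_; s≤s; z≤n; allUpTo?)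
import Data.Nat as ℕ
import Data.Nat.Properties as ℕ
open import Data.Nat.Divisibility using (_∣_; divides; _∣0; ∣-trans)
import Data.Nat.Divisibility as ℕ
open import Data.Nat.DivMod using (m/n*n≡m)
open import Data.Nat.GCD using (gcd; gcd[m,n]≢0; gcd[m,n]∣m; gcd[m,n]∣n)
open import Data.Nat.Coprimality using (Coprime; coprime-/gcd; coprime-divisor)
import Data.Nat.Coprimality as Coprime
open import Data.Product using (_×_; _,_; proj₁; proj₂; ∃-syntax)
open import Data.Sum using (_⊎_; inj₁; inj₂; [_,_]′)
open import Function.Base using (_∘_; id; flip)
open import Function.Bundles using (_⇔_; mk⇔; Equivalence)
open import Function.Properties.Equivalence using () renaming (sym to ⇔-sym; trans to ⇔-trans)
open import Relation.Binary.PropositionalEquality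
open import Relation.Nullary using (¬_; Dec; ¬?; contradiction)
open import Relation.Nullary.Decidable using (_×-dec_; _→-dec_; map; map′; from-yes)
open import Relation.Unary using (Decidable)
open import Algebra.Properties.AbelianGroup ℤ.+-0-abelianGroup using (inverseˡ-unique; inverseʳ-unique)
open +-*-Solver using (Polynomial; con; _:*_; _:-_; _:=_; solve)

*-≢0 : ∀ {i j} → i ≢ 0ℤ → j ≢ 0ℤ → i * j ≢ 0ℤ
*-≢0 {i} i≢0 j≢0 ij≡0 = [ i≢0 , j≢0 ]′ (ℤ.i*j≡0⇒i≡0∨j≡0 i ij≡0)

*-≡0-cancelˡ : ∀ {i j} → i ≢ 0ℤ → i * j ≡ 0ℤ → j ≡ 0ℤ
*-≡0-cancelˡ {i} i≢0 ij≡0 = [ flip contradiction i≢0 , id ]′ (ℤ.i*j≡0⇒i≡0∨j≡0 i ij≡0)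

*-≡0-cancelʳ : ∀ {i j} → j ≢ 0ℤ → i * j ≡ 0ℤ → i ≡ 0ℤ
*-≡0-cancelʳ {i} {j} j≢0 ij≡0 = *-≡0-cancelˡ j≢0 (trans (ℤ.*-comm j i) ij≡0)

i≡-i*-1 : ∀ i → i ≡ - i * - 1ℤ
i≡-i*-1 = solve-∀

-[2i]≡-i*2 : ∀ i → - (+ 2 * i) ≡ - i * + 2
-[2i]≡-i*2 = solve-∀

square≡+∣∣² : ∀ i → i * i ≡ + (∣ i ∣ ℕ.* ∣ i ∣)
square≡+∣∣² (+ n) = ℤ.+◃n≡+n (n ℕ.* n)
square≡+∣∣² -[1+ n ] = ℤ.+◃n≡+n (suc n ℕ.* suc n)

+m≡-+n⇒m≡0 : ∀ {m n} → + m ≡ - + n → m ≡ 0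
+m≡-+n⇒m≡0 {zero} _ = refl
+m≡-+n⇒m≡0 {suc m} {zero} ()
+m≡-+n⇒m≡0 {suc m} {suc n} ()

m*n<n⇒m≡0 : ∀ {m n} → m ℕ.* n < n → m ≡ 0
m*n<n⇒m≡0 {zero} _ = refl
m*n<n⇒m≡0 {suc m} {n} mn<n = contradiction (ℕ.m≤m+n n (m ℕ.* n)) (ℕ.<⇒≱ mn<n)

-- i·n = r + q·n with 0 ≤ r < n makes r = |i - q|·n a multiple of n below n.
[i*n]/ℕn≡i : ∀ i n .{{_ : ℕ.NonZero n}} → (i * + n) /ℕ n ≡ i
[i*n]/ℕn≡i i n = sym (ℤ.i-j≡0⇒i≡j i q (ℤ.∣i∣≡0⇒i≡0 (m*n<n⇒m≡0 ∣i-q∣*n<n)))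
  where
  open ≡-Reasoning
  q : ℤ
  q = (i * + n) /ℕ n
  r : ℕ
  r = (i * + n) %ℕ n
  factor : ∀ i q n → (i - q) * n ≡ i * n - q * n
  factor = solve-∀
  cancel : ∀ r q n → r + q * n - q * n ≡ r
  cancel = solve-∀
  [i-q]*n≡r : (i - q) * + n ≡ + r
  [i-q]*n≡r = begin
    (i - q) * + n           ≡⟨ factor i q (+ n) ⟩
    i * + n - q * + n       ≡⟨ cong (_- q * + n) (a≡a%ℕn+[a/ℕn]*n (i * + n) n) ⟩
    + r + q * + n - q * + n ≡⟨ cancel (+ r) q (+ n) ⟩
    + r                     ∎
  ∣i-q∣*n<n : ∣ i - q ∣ ℕ.* n < n
  ∣i-q∣*n<n = subst (_< n) (trans (cong ∣_∣ (sym [i-q]*n≡r)) (ℤ.abs-* (i - q) (+ n))) (n%ℕd<d (i * + n) n)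

1+4*[i-1]/ℕ4≡i : ∀ i → i %ℕ 4 ≡ 1 → + 1 + + 4 * ((i - + 1) /ℕ 4) ≡ i
1+4*[i-1]/ℕ4≡i i i%4≡1 = begin
  + 1 + + 4 * ((i - + 1) /ℕ 4)             ≡⟨ cong (λ z → + 1 + + 4 * ((z - + 1) /ℕ 4)) i≡1+q*4 ⟩
  + 1 + + 4 * ((+ 1 + q * + 4 - + 1) /ℕ 4) ≡⟨ cong (λ z → + 1 + + 4 * (z /ℕ 4)) (shift q) ⟩
  + 1 + + 4 * ((q * + 4) /ℕ 4)             ≡⟨ cong (λ z → + 1 + + 4 * z) ([i*n]/ℕn≡i q 4) ⟩
  + 1 + + 4 * q                            ≡⟨ cong (_+_ (+ 1)) (ℤ.*-comm (+ 4) q) ⟩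
  + 1 + q * + 4                            ≡⟨ i≡1+q*4 ⟨
  i                                        ∎
  where
  open ≡-Reasoning
  q : ℤ
  q = i /ℕ 4
  i≡1+q*4 : i ≡ + 1 + q * + 4
  i≡1+q*4 = subst (λ r → i ≡ + r + q * + 4) i%4≡1 (a≡a%ℕn+[a/ℕn]*n i 4)
  shift : ∀ q → + 1 + q * + 4 - + 1 ≡ q * + 4
  shift = solve-∀

SquareFreeℕ : ℕ → Set
SquareFreeℕ n = (m : ℕ) → m ℕ.* m ∣ n → m ≡ 1

squarefree-1 : SquareFreeℕ 1
squarefree-1 m mm∣1 = ℕ.m*n≡1⇒n≡1 m m (ℕ.∣1⇒≡1 mm∣1)

squarefree-3 : SquareFreeℕ 3
squarefree-3 zero 0∣3 = contradiction (ℕ.0∣⇒≡0 0∣3) λ ()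
squarefree-3 (suc zero) _ = refl
squarefree-3 (suc (suc m)) mm∣3 = contradiction (ℕ.∣⇒≤ mm∣3)
  (ℕ.<⇒≱ (ℕ.*-mono-≤ {2} {suc (suc m)} {2} (s≤s (s≤s z≤n)) (s≤s (s≤s z≤n))))

¬squarefree-0 : ¬ SquareFreeℕ 0
¬squarefree-0 sf = contradiction (sf 2 (4 ∣0)) λ ()

coprime-* : ∀ {m k n} → Coprime m n → Coprime k n → Coprime (m ℕ.* k) n
coprime-* {m} {k} {n} m⊥n k⊥n {d} (d∣mk , d∣n) = k⊥n (coprime-divisor d⊥m d∣mk , d∣n)
  where
  d⊥m : Coprime d m
  d⊥m (e∣d , e∣m) = m⊥n (e∣m , ∣-trans e∣d d∣n)

coprime-squares : ∀ {m n} → Coprime m n → Coprime (m ℕ.* m) (n ℕ.* n)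
coprime-squares {m} {n} m⊥n = Coprime.sym (coprime-* mm⊥n mm⊥n)
  where
  mm⊥n : Coprime n (m ℕ.* m)
  mm⊥n = Coprime.sym (coprime-* m⊥n m⊥n)

-- Divide u and v by their gcd; the reduced v′² then divides c, and the reduced u′² divides d.
squarefree-square-ratio : ∀ {c d u v} → SquareFreeℕ c → SquareFreeℕ d → v ≢ 0 →
                          d ℕ.* (v ℕ.* v) ≡ c ℕ.* (u ℕ.* u) → d ≡ c
squarefree-square-ratio {c} {d} {u} {v} sf-c sf-d v≢0 eq = begin
  d                 ≡⟨ d≡cu′² ⟩
  c ℕ.* (u′ ℕ.* u′) ≡⟨ cong (λ z → c ℕ.* (z ℕ.* z)) u′≡1 ⟩
  c ℕ.* 1           ≡⟨ ℕ.*-identityʳ c ⟩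
  c                 ∎
  where
  open ≡-Reasoning
  g : ℕ
  g = gcd u v
  instance
    g≢0 : ℕ.NonZero g
    g≢0 = ℕ.≢-nonZero (gcd[m,n]≢0 u v (inj₂ v≢0))
    gg≢0 : ℕ.NonZero (g ℕ.* g)
    gg≢0 = ℕ.m*n≢0 g g
  u′ v′ : ℕ
  u′ = u ℕ./ g
  v′ = v ℕ./ g
  scale : ∀ a x g → a ℕ.* (x ℕ.* x) ℕ.* (g ℕ.* g) ≡ a ℕ.* (x ℕ.* g ℕ.* (x ℕ.* g))
  scale = ℕ-Solver.solve-∀
  reduced : d ℕ.* (v′ ℕ.* v′) ≡ c ℕ.* (u′ ℕ.* u′)
  reduced = ℕ.*-cancelʳ-≡ _ _ (g ℕ.* g) (begin
    d ℕ.* (v′ ℕ.* v′) ℕ.* (g ℕ.* g) ≡⟨ scale d v′ g ⟩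
    d ℕ.* (v′ ℕ.* g ℕ.* (v′ ℕ.* g)) ≡⟨ cong (λ z → d ℕ.* (z ℕ.* z)) (m/n*n≡m (gcd[m,n]∣n u v)) ⟩
    d ℕ.* (v ℕ.* v)                 ≡⟨ eq ⟩
    c ℕ.* (u ℕ.* u)                 ≡⟨ cong (λ z → c ℕ.* (z ℕ.* z)) (m/n*n≡m (gcd[m,n]∣m u v)) ⟨
    c ℕ.* (u′ ℕ.* g ℕ.* (u′ ℕ.* g)) ≡⟨ scale c u′ g ⟨
    c ℕ.* (u′ ℕ.* u′) ℕ.* (g ℕ.* g) ∎)
  v′²∣c : v′ ℕ.* v′ ∣ c
  v′²∣c = coprime-divisor (coprime-squares (Coprime.sym (coprime-/gcd u v)))
            (divides d (trans (ℕ.*-comm (u′ ℕ.* u′) c) (sym reduced)))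
  d≡cu′² : d ≡ c ℕ.* (u′ ℕ.* u′)
  d≡cu′² = begin
    d                 ≡⟨ ℕ.*-identityʳ d ⟨
    d ℕ.* 1           ≡⟨ cong (λ z → d ℕ.* (z ℕ.* z)) (sf-c v′ v′²∣c) ⟨
    d ℕ.* (v′ ℕ.* v′) ≡⟨ reduced ⟩
    c ℕ.* (u′ ℕ.* u′) ∎
  u′≡1 : u′ ≡ 1
  u′≡1 = sf-d u′ (divides c d≡cu′²)

squarefree-neg-square-ratio : ∀ {D c w t} → SquareFree D → SquareFreeℕ c → w ≢ 0ℤ →
                              D * (w * w) ≡ - (+ c * (t * t)) → D ≡ - + c
squarefree-neg-square-ratio {D} {c} {w} {t} sf-D sf-c w≢0 eq = on-sign D sf-D (begin
  D * + W           ≡⟨ cong (D *_) (square≡+∣∣² w) ⟨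
  D * (w * w)       ≡⟨ eq ⟩
  - (+ c * (t * t)) ≡⟨ cong (λ z → - (+ c * z)) (square≡+∣∣² t) ⟩
  - (+ c * + T)     ≡⟨ cong -_ (ℤ.pos-* c T) ⟨
  - + (c ℕ.* T)     ∎)
  where
  open ≡-Reasoning
  W T : ℕ
  W = ∣ w ∣ ℕ.* ∣ w ∣
  T = ∣ t ∣ ℕ.* ∣ t ∣
  ∣w∣≢0 : ∣ w ∣ ≢ 0
  ∣w∣≢0 = w≢0 ∘ ℤ.∣i∣≡0⇒i≡0
  W≢0 : W ≢ 0
  W≢0 W≡0 = [ ∣w∣≢0 , ∣w∣≢0 ]′ (ℕ.m*n≡0⇒m≡0∨n≡0 ∣ w ∣ W≡0)
  on-sign : ∀ D → SquareFree D → D * + W ≡ - + (c ℕ.* T) → D ≡ - + c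
  on-sign (+ n) sf e = contradiction (subst SquareFreeℕ n≡0 sf) ¬squarefree-0
    where
    n≡0 : n ≡ 0
    n≡0 = [ id , flip contradiction W≢0 ]′
            (ℕ.m*n≡0⇒m≡0∨n≡0 n (+m≡-+n⇒m≡0 (trans (sym (ℤ.+◃n≡+n (n ℕ.* W))) e)))
  on-sign -[1+ n ] sf e = cong (-_ ∘ +_) (squarefree-square-ratio {u = ∣ t ∣} sf-c sf ∣w∣≢0
    (ℤ.+-injective (ℤ.neg-injective (trans (sym (ℤ.-◃n≡-n _)) e))))

LeastPositive : (ℕ → Set) → ℕ → Set
LeastPositive P j = 1 ≤ j × P j × ((s : ℕ) → 1 ≤ s → s < j → ¬ P s)

LeastPositive-map : ∀ {P Q : ℕ → Set} {j} → (∀ n → P n → Q n) → (∀ n → Q n → P n) →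
                    LeastPositive P j → LeastPositive Q j
LeastPositive-map {j = j} P⇒Q Q⇒P (1≤j , Pj , minimal) =
  1≤j , P⇒Q j Pj , λ s 1≤s s<j Qs → minimal s 1≤s s<j (Q⇒P s Qs)

LeastPositive-⇔ : ∀ {P Q : ℕ → Set} {j} → (∀ n → P n ⇔ Q n) → LeastPositive P j ⇔ LeastPositive Q j
LeastPositive-⇔ {P} {Q} P⇔Q = mk⇔ (LeastPositive-map to from) (LeastPositive-map from to)
  where
  to : ∀ n → P n → Q n
  to n = Equivalence.to (P⇔Q n)
  from : ∀ n → Q n → P n
  from n = Equivalence.from (P⇔Q n)

LeastPositive-1 : ∀ {P : ℕ → Set} → LeastPositive P 1 ⇔ P 1
LeastPositive-1 = mk⇔ (proj₁ ∘ proj₂) λ P1 → s≤s z≤n , P1 , λ s 1≤s s<1 → contradiction 1≤s (ℕ.<⇒≱ s<1)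

leastPositive? : ∀ {P : ℕ → Set} → Decidable P → Decidable (LeastPositive P)
leastPositive? P? j = (1 ≤? j) ×-dec P? j ×-dec
  map′ (λ h s 1≤s s<j → h s<j 1≤s) (λ h {s} s<j 1≤s → h s 1≤s s<j)
       (allUpTo? (λ s → (1 ≤? s) →-dec ¬? (P? s)) j)

lucasU : ℤ → ℤ → ℕ → ℤ
lucasU P Q zero = 0ℤ
lucasU P Q (suc zero) = 1ℤ
lucasU P Q (suc (suc n)) = P * lucasU P Q (suc n) - Q * lucasU P Q n

-- ⟦ lucasU-syntax P Q n ⟧ unfolds to lucasU ⟦ P ⟧ ⟦ Q ⟧ n, so closed forms of lucasU are solver goals.
lucasU-syntax : ∀ {m} → Polynomial m → Polynomial m → ℕ → Polynomial m
lucasU-syntax P Q zero = con 0ℤ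
lucasU-syntax P Q (suc zero) = con 1ℤ
lucasU-syntax P Q (suc (suc n)) = P :* lucasU-syntax P Q (suc n) :- Q :* lucasU-syntax P Q n

lucasU-2 : ∀ P Q → lucasU P Q 2 ≡ P
lucasU-2 = solve 2 (λ P Q → lucasU-syntax P Q 2 := P) refl

lucasU-3 : ∀ P Q → lucasU P Q 3 ≡ P * P - Q
lucasU-3 = solve 2 (λ P Q → lucasU-syntax P Q 3 := P :* P :- Q) refl

lucasU-4 : ∀ P Q → lucasU P Q 4 ≡ P * (P * P - + 2 * Q)
lucasU-4 = solve 2 (λ P Q → lucasU-syntax P Q 4 := P :* (P :* P :- con (+ 2) :* Q)) refl

lucasU-6 : ∀ P Q → lucasU P Q 6 ≡ P * (P * P - Q) * (P * P - + 3 * Q)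
lucasU-6 = solve 2 (λ P Q → lucasU-syntax P Q 6 := P :* (P :* P :- Q) :* (P :* P :- con (+ 3) :* Q)) refl

-- A record rather than a definition, so that unification never unfolds lucasU P Q j
-- (whose normal form grows exponentially in j).
record Rank (P Q : ℤ) (j : ℕ) : Set where
  constructor rank
  field leastZero : LeastPositive (λ n → lucasU P Q n ≡ 0ℤ) j

rank-2 : ∀ {P Q} → Rank P Q 2 ⇔ P ≡ 0ℤ
rank-2 {P} {Q} = mk⇔ (λ (rank (_ , U₂≡0 , _)) → trans (sym (lucasU-2 P Q)) U₂≡0) λ P≡0 → rank
  (s≤s z≤n , trans (lucasU-2 P Q) P≡0 , λ { 1 _ _ () ; (suc (suc _)) _ (s≤s (s≤s ())) })

rank-3⇒ : ∀ {P Q} → Rank P Q 3 → P * P ≡ Q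
rank-3⇒ {P} {Q} (rank (_ , U₃≡0 , _)) = ℤ.i-j≡0⇒i≡j _ _ (trans (sym (lucasU-3 P Q)) U₃≡0)

rank-4⇒ : ∀ {P Q} → Rank P Q 4 → P * P ≡ + 2 * Q
rank-4⇒ {P} {Q} (rank (_ , U₄≡0 , minimal)) =
  ℤ.i-j≡0⇒i≡j _ _ (*-≡0-cancelˡ P≢0 (trans (sym (lucasU-4 P Q)) U₄≡0))
  where
  P≢0 : P ≢ 0ℤ
  P≢0 P≡0 = minimal 2 (s≤s z≤n) (s≤s (s≤s (s≤s z≤n))) (trans (lucasU-2 P Q) P≡0)

rank-6⇒ : ∀ {P Q} → Rank P Q 6 → P * P ≡ + 3 * Q
rank-6⇒ {P} {Q} (rank (_ , U₆≡0 , minimal)) =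
  ℤ.i-j≡0⇒i≡j _ _ (*-≡0-cancelˡ (*-≢0 P≢0 P²-Q≢0) (trans (sym (lucasU-6 P Q)) U₆≡0))
  where
  P≢0 : P ≢ 0ℤ
  P≢0 P≡0 = minimal 2 (s≤s z≤n) (s≤s (s≤s (s≤s z≤n))) (trans (lucasU-2 P Q) P≡0)
  P²-Q≢0 : P * P - Q ≢ 0ℤ
  P²-Q≢0 P²-Q≡0 = minimal 3 (s≤s z≤n) (s≤s (s≤s (s≤s (s≤s z≤n)))) (trans (lucasU-3 P Q) P²-Q≡0)

-- θ is a root of X² - θ-trace D · X + θ-norm D, as encoded in mulAux.
θ-trace : ℤ → ℤ
θ-trace D with D %ℕ 4
... | 1 = 1ℤ
... | _ = 0ℤ

θ-norm : ℤ → ℤ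
θ-norm D with D %ℕ 4
... | 1 = - ((D - + 1) /ℕ 4)
... | _ = - D

trace : {D : ℤ} → 𝒪 D → ℤ
trace {D} ⟨ a , b ⟩ = + 2 * a + θ-trace D * b

norm : {D : ℤ} → 𝒪 D → ℤ
norm {D} ⟨ a , b ⟩ = a * a + θ-trace D * (a * b) + θ-norm D * (b * b)

i+j*k≡i-[-k]*j : ∀ i j k → i + j * k ≡ i - - k * j
i+j*k≡i-[-k]*j = solve-∀

·-≡ : {D : ℤ} (x y : 𝒪 D) →
      x · y ≡ ⟨ fst x * fst y - θ-norm D * (snd x * snd y) ,
                fst x * snd y + snd x * fst y + θ-trace D * (snd x * snd y) ⟩
·-≡ {D} ⟨ a , b ⟩ ⟨ c , d ⟩ with D %ℕ 4
... | 0           = cong₂ ⟨_,_⟩ (i+j*k≡i-[-k]*j (a * c) (b * d) D) (sym (ℤ.+-identityʳ _))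
... | 1           = cong₂ ⟨_,_⟩ (i+j*k≡i-[-k]*j (a * c) (b * d) ((D - + 1) /ℕ 4))
                                (cong (_+_ (a * d + b * c)) (sym (ℤ.*-identityˡ _)))
... | suc (suc _) = cong₂ ⟨_,_⟩ (i+j*k≡i-[-k]*j (a * c) (b * d) D) (sym (ℤ.+-identityʳ _))

⊙-· : {D : ℤ} (k m : ℤ) (x y : 𝒪 D) → (k ⊙ x) · (m ⊙ y) ≡ (k * m) ⊙ (x · y)
⊙-· {D} k m x@(⟨ a , b ⟩) y@(⟨ c , d ⟩) =
  trans (·-≡ (k ⊙ x) (m ⊙ y))
        (trans (cong₂ ⟨_,_⟩ (scale-fst k m a b c d (θ-norm D)) (scale-snd k m a b c d (θ-trace D)))
               (cong ((k * m) ⊙_) (sym (·-≡ x y))))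
  where
  scale-fst : ∀ k m a b c d f → k * a * (m * c) - f * (k * b * (m * d)) ≡ k * m * (a * c - f * (b * d))
  scale-fst = solve-∀
  scale-snd : ∀ k m a b c d e →
              k * a * (m * d) + k * b * (m * c) + e * (k * b * (m * d)) ≡ k * m * (a * d + b * c + e * (b * d))
  scale-snd = solve-∀

⊙-^ : {D : ℤ} (k : ℤ) (x : 𝒪 D) (n : ℕ) → (k ⊙ x) ^ n ≡ (k ℤ.^ n) ⊙ (x ^ n)
⊙-^ k x zero = refl
⊙-^ k x (suc n) = trans (cong ((k ⊙ x) ·_) (⊙-^ k x n)) (⊙-· k (k ℤ.^ n) x (x ^ n))

-- Cayley–Hamilton: x² = trace x · x - norm x.
^-suc : {D : ℤ} (x : 𝒪 D) (n : ℕ) →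
        let u = lucasU (trace x) (norm x) in
        x ^ suc n ≡ ⟨ u (suc n) * fst x - norm x * u n , u (suc n) * snd x ⟩
^-suc {D} x@(⟨ a , b ⟩) zero =
  trans (·-≡ x 𝟙) (cong₂ ⟨_,_⟩ (base-fst a b (θ-norm D) (norm x)) (base-snd a b (θ-trace D)))
  where
  base-fst : ∀ a b f N → a * 1ℤ - f * (b * 0ℤ) ≡ 1ℤ * a - N * 0ℤ
  base-fst = solve-∀
  base-snd : ∀ a b e → a * 0ℤ + b * 1ℤ + e * (b * 0ℤ) ≡ 1ℤ * b
  base-snd = solve-∀
^-suc {D} x@(⟨ a , b ⟩) (suc n) =
  trans (cong (x ·_) (^-suc x n))
        (trans (·-≡ x _) (cong₂ ⟨_,_⟩ (step-fst a b (θ-trace D) (θ-norm D) _ _)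
                                      (step-snd a b (θ-trace D) (θ-norm D) _ _)))
  where
  step-fst : ∀ a b e f u′ u →
             let t = + 2 * a + e * b ; N = a * a + e * (a * b) + f * (b * b) in
             a * (u′ * a - N * u) - f * (b * (u′ * b)) ≡ (t * u′ - N * u) * a - N * u′
  step-fst = solve-∀
  step-snd : ∀ a b e f u′ u →
             let t = + 2 * a + e * b ; N = a * a + e * (a * b) + f * (b * b) in
             a * (u′ * b) + b * (u′ * a - N * u) + e * (b * (u′ * b)) ≡ (t * u′ - N * u) * b
  step-snd = solve-∀

snd-^ : {D : ℤ} (x : 𝒪 D) (n : ℕ) → snd (x ^ n) ≡ lucasU (trace x) (norm x) n * snd x
snd-^ x zero = refl
snd-^ x (suc n) = cong snd (^-suc x n)

IsInt⇔snd≡0 : {D : ℤ} {y : 𝒪 D} → IsInt y ⇔ snd y ≡ 0ℤ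
IsInt⇔snd≡0 {y = y} = mk⇔ (λ { (_ , refl) → refl }) λ b≡0 → fst y , cong ⟨ fst y ,_⟩ b≡0

isInt? : {D : ℤ} (y : 𝒪 D) → Dec (IsInt y)
isInt? y = map (⇔-sym IsInt⇔snd≡0) (snd y ℤ.≟ 0ℤ)

IsInt-⊙ : {D : ℤ} {k : ℤ} {y : 𝒪 D} → k ≢ 0ℤ → IsInt (k ⊙ y) ⇔ IsInt y
IsInt-⊙ {k = k} {y} k≢0 = ⇔-trans IsInt⇔snd≡0 (⇔-trans
  (mk⇔ (*-≡0-cancelˡ k≢0) (λ b≡0 → trans (cong (k *_) b≡0) (ℤ.*-zeroʳ k)))
  (⇔-sym IsInt⇔snd≡0))

IsInt-^ : {D : ℤ} {x : 𝒪 D} (n : ℕ) → snd x ≢ 0ℤ → IsInt (x ^ n) ⇔ lucasU (trace x) (norm x) n ≡ 0ℤ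
IsInt-^ {x = x} n b≢0 = ⇔-trans IsInt⇔snd≡0
  (mk⇔ (λ e → *-≡0-cancelʳ b≢0 (trans (sym (snd-^ x n)) e))
       (λ u≡0 → trans (snd-^ x n) (cong (_* snd x) u≡0)))

IsInt-^1 : {D : ℤ} {x : 𝒪 D} → IsInt (x ^ 1) ⇔ IsInt x
IsInt-^1 {x = x} = ⇔-trans IsInt⇔snd≡0 (⇔-trans
  (mk⇔ (trans (sym snd-x^1)) (trans snd-x^1))
  (⇔-sym IsInt⇔snd≡0))
  where
  snd-x^1 : snd (x ^ 1) ≡ snd x
  snd-x^1 = trans (snd-^ x 1) (ℤ.*-identityˡ (snd x))

hasExponent? : {D : ℤ} (x : 𝒪 D) (j : ℕ) → Dec (HasExponent x j)
hasExponent? x = leastPositive? (λ n → isInt? (x ^ n))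

HasExponent-⊙ : {D k : ℤ} {x : 𝒪 D} {j : ℕ} → k ≢ 0ℤ → HasExponent (k ⊙ x) j ⇔ HasExponent x j
HasExponent-⊙ {k = k} {x} k≢0 = LeastPositive-⇔ λ n →
  subst (λ z → IsInt z ⇔ IsInt (x ^ n)) (sym (⊙-^ k x n)) (IsInt-⊙ (k≢0 ∘ ℤ.i^n≡0⇒i≡0 k n))

exponent-1 : {D : ℤ} (x : 𝒪 D) → HasExponent x 1 ⇔ IsInt x
exponent-1 x = ⇔-trans LeastPositive-1 IsInt-^1

exponent≥2⇒snd≢0 : {D : ℤ} (x : 𝒪 D) {j : ℕ} → 2 ≤ j → HasExponent x j → snd x ≢ 0ℤ
exponent≥2⇒snd≢0 x 2≤j (_ , _ , minimal) b≡0 =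
  minimal 1 (s≤s z≤n) 2≤j (Equivalence.from IsInt-^1 (Equivalence.from IsInt⇔snd≡0 b≡0))

exponent⇔rank : {D : ℤ} (x : 𝒪 D) {j : ℕ} → snd x ≢ 0ℤ → HasExponent x j ⇔ Rank (trace x) (norm x) j
exponent⇔rank x b≢0 = ⇔-trans (LeastPositive-⇔ λ n → IsInt-^ n b≢0) (mk⇔ rank Rank.leastZero)

exponent⇒rank : {D : ℤ} (x : 𝒪 D) {j : ℕ} → 2 ≤ j → HasExponent x j → Rank (trace x) (norm x) j
exponent⇒rank x 2≤j h = Equivalence.to (exponent⇔rank x (exponent≥2⇒snd≢0 x 2≤j h)) h

-- 2x = trace x + √D-coeff x · √D.
√D-coeff : {D : ℤ} → 𝒪 D → ℤ
√D-coeff {D} x with D %ℕ 4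
... | 1 = snd x
... | _ = + 2 * snd x

√D-coeff≢0 : {D : ℤ} (x : 𝒪 D) → snd x ≢ 0ℤ → √D-coeff x ≢ 0ℤ
√D-coeff≢0 {D} x b≢0 with D %ℕ 4
... | 0           = *-≢0 {+ 2} (λ ()) b≢0
... | 1           = b≢0
... | suc (suc _) = *-≢0 {+ 2} (λ ()) b≢0

discriminant-θ²≡D : ∀ a b D → D * (+ 2 * b * (+ 2 * b)) ≡
                    (+ 2 * a + 0ℤ * b) * (+ 2 * a + 0ℤ * b) - + 4 * (a * a + 0ℤ * (a * b) + - D * (b * b))
discriminant-θ²≡D = solve-∀

discriminant : {D : ℤ} (x : 𝒪 D) → D * (√D-coeff x * √D-coeff x) ≡ trace x * trace x - + 4 * norm x
discriminant {D} ⟨ a , b ⟩ with D %ℕ 4 in D%4≡r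
... | 0           = discriminant-θ²≡D a b D
... | suc (suc _) = discriminant-θ²≡D a b D
... | 1           = trans (cong (_* (b * b)) (sym (1+4*[i-1]/ℕ4≡i D D%4≡r))) (odd a b ((D - + 1) /ℕ 4))
  where
  odd : ∀ a b f → (+ 1 + + 4 * f) * (b * b) ≡
                  (+ 2 * a + 1ℤ * b) * (+ 2 * a + 1ℤ * b) - + 4 * (a * a + 1ℤ * (a * b) + - f * (b * b))
  odd = solve-∀

scalar≢0 : {D k : ℤ} {x y : 𝒪 D} → x ≡ k ⊙ y → snd x ≢ 0ℤ → k ≢ 0ℤ
scalar≢0 refl b≢0 refl = b≢0 refl

trace-sqrtD : (D : ℤ) → trace (sqrtD D) ≡ 0ℤ
trace-sqrtD D with D %ℕ 4
... | 0           = refl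
... | 1           = refl
... | suc (suc _) = refl

snd-sqrtD≢0 : (D : ℤ) → snd (sqrtD D) ≢ 0ℤ
snd-sqrtD≢0 D with D %ℕ 4
... | 0           = λ ()
... | 1           = λ ()
... | suc (suc _) = λ ()

sqrtD-exponent : (D : ℤ) → HasExponent (sqrtD D) 2
sqrtD-exponent D = Equivalence.from (exponent⇔rank (sqrtD D) (snd-sqrtD≢0 D)) (Equivalence.from rank-2 (trace-sqrtD D))

traceless-θ²≡D : {D : ℤ} (a b : ℤ) → + 2 * a + 0ℤ ≡ 0ℤ → ⟨ a , b ⟩ ≡ b ⊙ ⟨_,_⟩ {D} 0ℤ 1ℤ
traceless-θ²≡D a b 2a+0≡0 = cong₂ ⟨_,_⟩ (trans a≡0 (sym (ℤ.*-zeroʳ b))) (sym (ℤ.*-identityʳ b))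
  where
  a≡0 : a ≡ 0ℤ
  a≡0 = *-≡0-cancelˡ {+ 2} (λ ()) (trans (sym (ℤ.+-identityʳ (+ 2 * a))) 2a+0≡0)

traceless⇒multiple-of-√D : {D : ℤ} (x : 𝒪 D) → trace x ≡ 0ℤ → ∃[ k ] x ≡ k ⊙ sqrtD D
traceless⇒multiple-of-√D {D} ⟨ a , b ⟩ t≡0 with D %ℕ 4
... | 0           = b , traceless-θ²≡D a b t≡0
... | suc (suc _) = b , traceless-θ²≡D a b t≡0
... | 1           = - a , cong₂ ⟨_,_⟩ (i≡-i*-1 a) (begin
  b           ≡⟨ ℤ.*-identityˡ b ⟨
  1ℤ * b      ≡⟨ inverseʳ-unique (+ 2 * a) (1ℤ * b) t≡0 ⟩
  - (+ 2 * a) ≡⟨ -[2i]≡-i*2 a ⟩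
  - a * + 2   ∎)
  where open ≡-Reasoning

exponent-2 : {D : ℤ} (x : 𝒪 D) → HasExponent x 2 ⇔ (∃[ k ] (¬ (k ≡ + 0) × x ≡ k ⊙ sqrtD D))
exponent-2 {D} x = mk⇔ to from
  where
  to : HasExponent x 2 → ∃[ k ] (¬ (k ≡ + 0) × x ≡ k ⊙ sqrtD D)
  to h = let (k , x≡k√D) = traceless⇒multiple-of-√D x (Equivalence.to rank-2 (exponent⇒rank x ℕ.≤-refl h))
         in k , scalar≢0 x≡k√D (exponent≥2⇒snd≢0 x ℕ.≤-refl h) , x≡k√D
  from : ∃[ k ] (¬ (k ≡ + 0) × x ≡ k ⊙ sqrtD D) → HasExponent x 2
  from (k , k≢0 , x≡k√D) = subst (λ z → HasExponent z 2) (sym x≡k√D)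
                             (Equivalence.from (HasExponent-⊙ k≢0) (sqrtD-exponent D))

module _ {D : ℤ} (x : 𝒪 D) (sf : SquareFree D) where
  private
    t N w : ℤ
    t = trace x
    N = norm x
    w = √D-coeff x

  exponent-3⇒D≡-3 : HasExponent x 3 → D ≡ - + 3
  exponent-3⇒D≡-3 h = squarefree-neg-square-ratio {w = w} {t = t} sf squarefree-3 w≢0 (begin
    D * (w * w)           ≡⟨ discriminant x ⟩
    t * t - + 4 * N       ≡⟨ cong (λ z → t * t - + 4 * z) t²≡N ⟨
    t * t - + 4 * (t * t) ≡⟨ collect t ⟩
    - (+ 3 * (t * t))     ∎)
    where
    open ≡-Reasoning
    w≢0 : w ≢ 0ℤ
    w≢0 = √D-coeff≢0 x (exponent≥2⇒snd≢0 x (s≤s (s≤s z≤n)) h)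
    t²≡N : t * t ≡ N
    t²≡N = rank-3⇒ (exponent⇒rank x (s≤s (s≤s z≤n)) h)
    collect : ∀ t → t * t - + 4 * (t * t) ≡ - (+ 3 * (t * t))
    collect = solve-∀

  exponent-4⇒D≡-1 : HasExponent x 4 → D ≡ - + 1
  exponent-4⇒D≡-1 h = squarefree-neg-square-ratio {w = w} {t = t} sf squarefree-1 w≢0 (begin
    D * (w * w)             ≡⟨ discriminant x ⟩
    t * t - + 4 * N         ≡⟨ regroup t N ⟩
    t * t - + 2 * (+ 2 * N) ≡⟨ cong (λ z → t * t - + 2 * z) t²≡2N ⟨
    t * t - + 2 * (t * t)   ≡⟨ collect t ⟩
    - (+ 1 * (t * t))       ∎)
    where
    open ≡-Reasoning
    w≢0 : w ≢ 0ℤ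
    w≢0 = √D-coeff≢0 x (exponent≥2⇒snd≢0 x (s≤s (s≤s z≤n)) h)
    t²≡2N : t * t ≡ + 2 * N
    t²≡2N = rank-4⇒ (exponent⇒rank x (s≤s (s≤s z≤n)) h)
    regroup : ∀ t N → t * t - + 4 * N ≡ t * t - + 2 * (+ 2 * N)
    regroup = solve-∀
    collect : ∀ t → t * t - + 2 * (t * t) ≡ - (+ 1 * (t * t))
    collect = solve-∀

  -- Here D w² = -N and t² = 3N, so D (3w)² = -3t².
  exponent-6⇒D≡-3 : HasExponent x 6 → D ≡ - + 3
  exponent-6⇒D≡-3 h = squarefree-neg-square-ratio {w = + 3 * w} {t = t} sf squarefree-3 3w≢0 (begin
    D * (+ 3 * w * (+ 3 * w))        ≡⟨ nine D w ⟩
    + 9 * (D * (w * w))              ≡⟨ cong (+ 9 *_) (discriminant x) ⟩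
    + 9 * (t * t - + 4 * N)          ≡⟨ regroup t N ⟩
    + 9 * (t * t) - + 12 * (+ 3 * N) ≡⟨ cong (λ z → + 9 * (t * t) - + 12 * z) t²≡3N ⟨
    + 9 * (t * t) - + 12 * (t * t)   ≡⟨ collect t ⟩
    - (+ 3 * (t * t))                ∎)
    where
    open ≡-Reasoning
    3w≢0 : + 3 * w ≢ 0ℤ
    3w≢0 = *-≢0 {+ 3} (λ ()) (√D-coeff≢0 x (exponent≥2⇒snd≢0 x (s≤s (s≤s z≤n)) h))
    t²≡3N : t * t ≡ + 3 * N
    t²≡3N = rank-6⇒ (exponent⇒rank x (s≤s (s≤s z≤n)) h)
    nine : ∀ D w → D * (+ 3 * w * (+ 3 * w)) ≡ + 9 * (D * (w * w))
    nine = solve-∀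
    regroup : ∀ t N → + 9 * (t * t - + 4 * N) ≡ + 9 * (t * t) - + 12 * (+ 3 * N)
    regroup = solve-∀
    collect : ∀ t → + 9 * (t * t) - + 12 * (t * t) ≡ - (+ 3 * (t * t))
    collect = solve-∀

exponent⇔nonzero-multiple : {D : ℤ} {j : ℕ} {y₁ y₂ : 𝒪 D} →
  2 ≤ j → HasExponent y₁ j → HasExponent y₂ j →
  ((x : 𝒪 D) → HasExponent x j → ∃[ k ] (x ≡ k ⊙ y₁ ⊎ x ≡ k ⊙ y₂)) →
  (x : 𝒪 D) → HasExponent x j ⇔ (∃[ k ] (¬ (k ≡ + 0) × (x ≡ k ⊙ y₁ ⊎ x ≡ k ⊙ y₂)))
exponent⇔nonzero-multiple {j = j} {y₁} {y₂} 2≤j h₁ h₂ multiple x = mk⇔ to from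
  where
  to : HasExponent x j → ∃[ k ] (¬ (k ≡ + 0) × (x ≡ k ⊙ y₁ ⊎ x ≡ k ⊙ y₂))
  to h = let (k , x≡ky) = multiple x h
             b≢0 = exponent≥2⇒snd≢0 x 2≤j h
         in k , [ flip scalar≢0 b≢0 , flip scalar≢0 b≢0 ]′ x≡ky , x≡ky
  from : ∃[ k ] (¬ (k ≡ + 0) × (x ≡ k ⊙ y₁ ⊎ x ≡ k ⊙ y₂)) → HasExponent x j
  from (k , k≢0 , inj₁ x≡ky₁) =
    subst (λ z → HasExponent z j) (sym x≡ky₁) (Equivalence.from (HasExponent-⊙ k≢0) h₁)
  from (k , k≢0 , inj₂ x≡ky₂) =
    subst (λ z → HasExponent z j) (sym x≡ky₂) (Equivalence.from (HasExponent-⊙ k≢0) h₂)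

exponent-3⇒multiple : (x : 𝒪 (- + 3)) → HasExponent x 3 → ∃[ k ] (x ≡ k ⊙ ω ⊎ x ≡ k ⊙ conj ω)
exponent-3⇒multiple x h = [ on-ω̄ , on-ω ]′ (ℤ.i*j≡0⇒i≡0∨j≡0 a a[a+b]≡0)
  where
  a b : ℤ
  a = fst x
  b = snd x
  factor : ∀ a b → + 3 * (a * (a + b)) ≡
                   (+ 2 * a + 1ℤ * b) * (+ 2 * a + 1ℤ * b) - (a * a + 1ℤ * (a * b) + 1ℤ * (b * b))
  factor = solve-∀
  a[a+b]≡0 : a * (a + b) ≡ 0ℤ
  a[a+b]≡0 = *-≡0-cancelˡ {+ 3} (λ ())
    (trans (factor a b) (ℤ.i≡j⇒i-j≡0 (rank-3⇒ (exponent⇒rank x (s≤s (s≤s z≤n)) h))))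
  on-ω̄ : a ≡ 0ℤ → ∃[ k ] (x ≡ k ⊙ ω ⊎ x ≡ k ⊙ conj ω)
  on-ω̄ a≡0 = - b , inj₂ (cong₂ ⟨_,_⟩ (trans a≡0 (sym (ℤ.*-zeroʳ (- b)))) (i≡-i*-1 b))
  on-ω : a + b ≡ 0ℤ → ∃[ k ] (x ≡ k ⊙ ω ⊎ x ≡ k ⊙ conj ω)
  on-ω a+b≡0 = - a , inj₁ (cong₂ ⟨_,_⟩ (i≡-i*-1 a)
    (trans (inverseʳ-unique a b a+b≡0) (sym (ℤ.*-identityʳ (- a)))))

exponent-4⇒multiple : (x : 𝒪 (- + 1)) → HasExponent x 4 → ∃[ k ] (x ≡ k ⊙ 1+i ⊎ x ≡ k ⊙ conj 1+i)
exponent-4⇒multiple x h = [ on-1+i , on-1-i ]′ (ℤ.i*j≡0⇒i≡0∨j≡0 (a - b) [a-b][a+b]≡0)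
  where
  a b : ℤ
  a = fst x
  b = snd x
  factor : ∀ a b → + 2 * ((a - b) * (a + b)) ≡
                   (+ 2 * a + 0ℤ * b) * (+ 2 * a + 0ℤ * b) - + 2 * (a * a + 0ℤ * (a * b) + 1ℤ * (b * b))
  factor = solve-∀
  [a-b][a+b]≡0 : (a - b) * (a + b) ≡ 0ℤ
  [a-b][a+b]≡0 = *-≡0-cancelˡ {+ 2} (λ ())
    (trans (factor a b) (ℤ.i≡j⇒i-j≡0 (rank-4⇒ (exponent⇒rank x (s≤s (s≤s z≤n)) h))))
  a≡a*1 : a ≡ a * 1ℤ
  a≡a*1 = sym (ℤ.*-identityʳ a)
  on-1+i : a - b ≡ 0ℤ → ∃[ k ] (x ≡ k ⊙ 1+i ⊎ x ≡ k ⊙ conj 1+i)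
  on-1+i a-b≡0 = a , inj₁ (cong₂ ⟨_,_⟩ a≡a*1 (trans (sym (ℤ.i-j≡0⇒i≡j a b a-b≡0)) a≡a*1))
  on-1-i : a + b ≡ 0ℤ → ∃[ k ] (x ≡ k ⊙ 1+i ⊎ x ≡ k ⊙ conj 1+i)
  on-1-i a+b≡0 = a , inj₂ (cong₂ ⟨_,_⟩ a≡a*1
    (trans (inverseʳ-unique a b a+b≡0) (trans (cong -_ a≡a*1) (ℤ.neg-distribʳ-* a 1ℤ))))

exponent-6⇒multiple : (x : 𝒪 (- + 3)) → HasExponent x 6 →
                       ∃[ k ] (x ≡ k ⊙ (𝟙 ⊖ ω) ⊎ x ≡ k ⊙ (𝟙 ⊖ conj ω))
exponent-6⇒multiple x h = [ on-1-ω̄ , on-1-ω ]′ (ℤ.i*j≡0⇒i≡0∨j≡0 (a - b) [a-b][a+2b]≡0)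
  where
  a b : ℤ
  a = fst x
  b = snd x
  factor : ∀ a b → (a - b) * (a + + 2 * b) ≡
                   (+ 2 * a + 1ℤ * b) * (+ 2 * a + 1ℤ * b) - + 3 * (a * a + 1ℤ * (a * b) + 1ℤ * (b * b))
  factor = solve-∀
  [a-b][a+2b]≡0 : (a - b) * (a + + 2 * b) ≡ 0ℤ
  [a-b][a+2b]≡0 = trans (factor a b) (ℤ.i≡j⇒i-j≡0 (rank-6⇒ (exponent⇒rank x (s≤s (s≤s z≤n)) h)))
  a≡a*1 : a ≡ a * 1ℤ
  a≡a*1 = sym (ℤ.*-identityʳ a)
  on-1-ω̄ : a - b ≡ 0ℤ → ∃[ k ] (x ≡ k ⊙ (𝟙 ⊖ ω) ⊎ x ≡ k ⊙ (𝟙 ⊖ conj ω))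
  on-1-ω̄ a-b≡0 = a , inj₂ (cong₂ ⟨_,_⟩ a≡a*1 (trans (sym (ℤ.i-j≡0⇒i≡j a b a-b≡0)) a≡a*1))
  on-1-ω : a + + 2 * b ≡ 0ℤ → ∃[ k ] (x ≡ k ⊙ (𝟙 ⊖ ω) ⊎ x ≡ k ⊙ (𝟙 ⊖ conj ω))
  on-1-ω a+2b≡0 = - b , inj₁ (cong₂ ⟨_,_⟩
    (trans (inverseˡ-unique a (+ 2 * b) a+2b≡0) (-[2i]≡-i*2 b)) (i≡-i*-1 b))

ω-exponent : HasExponent ω 3
ω-exponent = from-yes (hasExponent? ω 3)

ω̄-exponent : HasExponent (conj ω) 3
ω̄-exponent = from-yes (hasExponent? (conj ω) 3)

1+i-exponent : HasExponent 1+i 4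
1+i-exponent = from-yes (hasExponent? 1+i 4)

1-i-exponent : HasExponent (conj 1+i) 4
1-i-exponent = from-yes (hasExponent? (conj 1+i) 4)

1-ω-exponent : HasExponent (𝟙 ⊖ ω) 6
1-ω-exponent = from-yes (hasExponent? (𝟙 ⊖ ω) 6)

1-ω̄-exponent : HasExponent (𝟙 ⊖ conj ω) 6
1-ω̄-exponent = from-yes (hasExponent? (𝟙 ⊖ conj ω) 6)

exponent-witness : {D₀ D : ℤ} {j : ℕ} {y : 𝒪 D₀} → HasExponent y j → D ≡ D₀ → ∃[ x ] HasExponent {D} x j
exponent-witness {y = y} h refl = y , h

proposition4p3 : (D : ℤ) → SquareFree D → ¬ (D ≡ + 1) →
    -- 1) E₁ = ℤ
    ((x : 𝒪 D) → HasExponent x 1 ⇔ IsInt x)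
    -- 2) E₂ = { k√D : k ≠ 0 }
    × ((x : 𝒪 D) → HasExponent x 2 ⇔ (∃[ k ] (¬ (k ≡ + 0) × x ≡ k ⊙ sqrtD D)))
    -- 3) E₃ ≠ ∅ ⇔ D = -3, and then E₃ = { kω, kω̄ : k ≠ 0 }
    × ((∃[ x ] HasExponent {D} x 3) ⇔ (D ≡ - + 3))
    × (D ≡ - + 3 → (x : 𝒪 (- + 3)) → HasExponent x 3 ⇔
         (∃[ k ] (¬ (k ≡ + 0) × (x ≡ (k ⊙ ω) ⊎ x ≡ (k ⊙ conj ω)))))
    -- 4) E₄ ≠ ∅ ⇔ D = -1, and then E₄ = { k(1+i), k(1-i) : k ≠ 0 }
    × ((∃[ x ] HasExponent {D} x 4) ⇔ (D ≡ - + 1))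
    × (D ≡ - + 1 → (x : 𝒪 (- + 1)) → HasExponent x 4 ⇔
         (∃[ k ] (¬ (k ≡ + 0) × (x ≡ (k ⊙ 1+i) ⊎ x ≡ (k ⊙ conj 1+i)))))
    -- 5) E₆ ≠ ∅ ⇔ D = -3, and then E₆ = { k(1-ω), k(1-ω̄) : k ≠ 0 }
    × ((∃[ x ] HasExponent {D} x 6) ⇔ (D ≡ - + 3))
    × (D ≡ - + 3 → (x : 𝒪 (- + 3)) → HasExponent x 6 ⇔
         (∃[ k ] (¬ (k ≡ + 0) × (x ≡ (k ⊙ (𝟙 ⊖ ω)) ⊎ x ≡ (k ⊙ (𝟙 ⊖ conj ω))))))
proposition4p3 D sf _ =
    exponent-1
  , exponent-2
  , mk⇔ (λ (x , h) → exponent-3⇒D≡-3 x sf h) (exponent-witness ω-exponent)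
  , (λ _ → exponent⇔nonzero-multiple (s≤s (s≤s z≤n)) ω-exponent ω̄-exponent exponent-3⇒multiple)
  , mk⇔ (λ (x , h) → exponent-4⇒D≡-1 x sf h) (exponent-witness 1+i-exponent)
  , (λ _ → exponent⇔nonzero-multiple (s≤s (s≤s z≤n)) 1+i-exponent 1-i-exponent exponent-4⇒multiple)
  , mk⇔ (λ (x , h) → exponent-6⇒D≡-3 x sf h) (exponent-witness 1-ω-exponent)
  , (λ _ → exponent⇔nonzero-multiple (s≤s (s≤s z≤n)) 1-ω-exponent 1-ω̄-exponent exponent-6⇒multiple)
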